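{- Let $a,b,c,n$ be positive integers with $a\geq b$ and $n\geq a+c$, and let $C$ be a $c$-subset of $[n]$. Let $A$ be the $a$-partner of $C$ and $B$ the $b$-partner of $C$. Then $B\prec A$ or $A$ is the $a$-parity of $B$.
   Context: Lexicographic order: for finite sets $A,B$ of positive integers, $A\prec B$ if either $A\supseteq B$ or $\min(A\setminus B)<\min(B\setminus A)$. $H$ is the partner of a nonempty set $F\subseteq[n]$ if there is $q$ with $F\cap H=\{q\}$ and $F\cup H=[q]$. For $F\subseteq[n]$ with $|F|=f$ and $k\le n-f$, let $H$ be the partner of $F$ and $h=|H|$; the $k$-partner $K$ of $F$ is: $K=H$ if $k=h$; $K=H\cup\{n-k+h+1,\dots,n\}$ if $k>h$; and if $k<h$, $K$ is the lexicographically last $k$-subset of $[n]$ with $K\prec H$. For $F\subseteq[n]$, $\ell(F)=\max\{x:[n-x+1,n]\subseteq F\}$ if $n\in F$ and $\ell(F)=0$ otherwise; $F^{\mathrm t}=[n-\ell(F)+1,n]$ (empty if $\ell(F)=0$). For $h_1\le h_2$, an $h_1$-set $H_1$ and an $h_2$-set $H_2$: $H_2$ is the $h_2$-parity of $H_1$ if $H_1\setminus H_1^{\mathrm t}=H_2\setminus H_2^{\mathrm t}$ and $\ell(H_2)-\ell(H_1)=h_2-h_1$. -}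

module Defs where

open import Data.Nat using (ℕ; zero; suc; _+_; _∸_; _≤_; _<_; _≤?_)
open import Data.Bool using (Bool; _∧_)
open import Data.Fin using (Fin; toℕ)
open import Data.Fin.Subset using (Subset; _∈_; _∉_; _⊆_; _∩_; _∪_; _─_; ∣_∣; ⁅_⁆)
open import Data.Vec using (tabulate)
open import Data.Product using (Σ; ∃; ∃₂; _×_)
open import Data.Sum using (_⊎_)
open import Relation.Nullary using (does; ¬_)
open import Relation.Binary.PropositionalEquality using (_≡_)

-- Convention: a subset of [n] = {1,…,n} is a 'Subset n'; the element
-- i : Fin n represents the positive integer  val i = toℕ i + 1.
val : ∀ {n} → Fin n → ℕ
val i = suc (toℕ i)

interval : (n lo hi : ℕ) → Subset n
interval n lo hi = tabulate (λ i → does (lo ≤? val i) ∧ does (val i ≤? hi))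

upto : (n q : ℕ) → Subset n
upto n q = interval n 1 q

IsMin : ∀ {n} → Subset n → Fin n → Set
IsMin S i = i ∈ S × (∀ {j} → j ∈ S → val i ≤ val j)

_≺_ : ∀ {n} → Subset n → Subset n → Set
A ≺ B = B ⊆ A ⊎ ∃₂ (λ i j → IsMin (A ─ B) i × IsMin (B ─ A) j × val i < val j)

IsPartner : ∀ {n} → Subset n → Subset n → Set
IsPartner {n} F H = ∃ λ q → (F ∩ H ≡ ⁅ q ⁆) × (F ∪ H ≡ upto n (val q))

IsLexLast : ∀ {n} → ℕ → Subset n → Subset n → Set
IsLexLast {n} k H K =
  ∣ K ∣ ≡ k × K ≺ H × (∀ (K′ : Subset n) → ∣ K′ ∣ ≡ k → K′ ≺ H → K′ ≺ K)

IsKPartner : (n k : ℕ) → Subset n → Subset n → Set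
IsKPartner n k F K = ∃ λ H → IsPartner F H ×
  ( (k ≡ ∣ H ∣ × K ≡ H)
  ⊎ (∣ H ∣ < k × K ≡ H ∪ interval n (n ∸ k + ∣ H ∣ + 1) n)
  ⊎ (k < ∣ H ∣ × IsLexLast k H K))

TopIn : ∀ {n} → Subset n → Set
TopIn {n} F = ∃ λ i → i ∈ F × val i ≡ n

tailSet : (n x : ℕ) → Subset n
tailSet n x = interval n (n ∸ x + 1) n

IsEll : (n : ℕ) → Subset n → ℕ → Set
IsEll n F x =
  (TopIn F → x ≤ n × tailSet n x ⊆ F × (∀ y → y ≤ n → tailSet n y ⊆ F → y ≤ x))
  × (¬ TopIn F → x ≡ 0)

-- H₂ (an h₂-set) is the h₂-parity of H₁ (an h₁-set), h₁ ≤ h₂: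
-- H₁ ∖ H₁ᵗ = H₂ ∖ H₂ᵗ and ℓ(H₂) - ℓ(H₁) = h₂ - h₁
-- (the latter written additively: ℓ(H₂) + h₁ = ℓ(H₁) + h₂).
IsParity : (n h₁ h₂ : ℕ) → Subset n → Subset n → Set
IsParity n h₁ h₂ H₁ H₂ = ∃₂ λ x₁ x₂ → IsEll n H₁ x₁ × IsEll n H₂ x₂ ×
  (H₁ ─ tailSet n x₁ ≡ H₂ ─ tailSet n x₂) × (x₂ + h₁ ≡ x₁ + h₂)

-- Let H be the partner of C, h = ∣ H ∣ and q = max H = h + c - 1.  For k ≥ h
-- the k-partner is H together with the top k - h elements of [n]; since
-- k + c ≤ n these lie strictly above q + 1, so its ℓ is k - h and removing that
-- tail gives back H: two such partners are parities of each other.  For k < h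
-- the k-partner precedes H, hence also every such padding of H.
-- If a, b < h, read A, B and H from 1 upwards.  The first element x at which
-- one of A, B leaves H is an element of that set outside H, and from there on
-- a lexicographically last set consists of top elements of [n].  If only B
-- leaves at x then B ≺ A; A cannot leave alone, since sets of size a that still
-- follow H at x precede H and would come after A; if both leave at x they
-- differ only in their top runs, and A is the a-parity of B.
module Submission where

open import Defs
open import Data.Nat using (ℕ; zero; suc; _+_; _∸_; _≤_; _<_; _≤?_; _<?_; z≤n; s≤s; s≤s⁻¹; s<s⁻¹; _≟_)
open import Data.Nat.Properties
open import Data.Bool using (true; false; _∧_)
open import Data.Bool.Properties using (∧-identityʳ)
open import Data.Fin using (Fin; toℕ; fromℕ; zero; suc)
open import Data.Fin.Properties using (toℕ<n; toℕ-fromℕ)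
open import Data.Fin.Subset using (Subset; _∈_; _∉_; _⊆_; _∪_; _─_; ∣_∣; ⊥; ⊤)
open import Data.Fin.Subset.Properties using (_∈?_; drop-∷-⊆; x∈p∧x∉q⇒x∈p─q; ∈⊤; ∣⊥∣≡0; ∣⊤∣≡n; ∣p∣≡n⇒p≡⊤; ∪-identityˡ; ∪-identityʳ; ∣p∣≤n)
open import Data.Vec using ([]; _∷_; here; there; tabulate)
open import Data.Vec.Properties using (tabulate-cong; ∷-injectiveʳ)
open import Data.Product using (∃; ∃₂; _×_; _,_)
open import Data.Sum as Sum using (_⊎_; inj₁; inj₂)
open import Data.Empty using (⊥-elim)
open import Function using (_∘_)
open import Function.Bundles using (_⇔_; mk⇔; module Equivalence)
open import Relation.Nullary using (does; ¬_; yes; no)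
open import Relation.Nullary.Decidable using (dec-true; dec-false; does-⇔)
open import Relation.Binary.PropositionalEquality

-- Position 0 of a 'Subset (suc n)' is the integer 1, which is among the
-- top j elements of [n + 1] iff n < j.
top : (n j : ℕ) → Subset n
top zero    j = []
top (suc n) j = does (n <? j) ∷ top n j

top-outside : ∀ n {j} → j ≤ n → top (suc n) j ≡ false ∷ top n j
top-outside n {j} j≤n = cong (_∷ top n j) (dec-false (n <? j) (≤⇒≯ j≤n))

top-full : ∀ n {j} → n ≤ j → top n j ≡ ⊤
top-full zero    _   = refl
top-full (suc n) n<j = cong₂ _∷_ (dec-true (n <? _) n<j) (top-full n (≤-trans (n≤1+n n) n<j))

top-zero : ∀ n → top n 0 ≡ ⊥
top-zero zero    = refl
top-zero (suc n) = cong (false ∷_) (top-zero n)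

∣top∣ : ∀ n {j} → j ≤ n → ∣ top n j ∣ ≡ j
∣top∣ zero    j≤0 = sym (n≤0⇒n≡0 j≤0)
∣top∣ (suc n) {j} j≤1+n with n <? j
... | yes n<j = begin
  ∣ does (n <? j) ∷ top n j ∣ ≡⟨ cong (λ b → ∣ b ∷ top n j ∣) (dec-true (n <? j) n<j) ⟩
  suc ∣ top n j ∣             ≡⟨ cong (λ s → suc ∣ s ∣) (top-full n (<⇒≤ n<j)) ⟩
  suc ∣ ⊤ {n} ∣               ≡⟨ cong suc (∣⊤∣≡n n) ⟩
  suc n                       ≡⟨ ≤-antisym n<j j≤1+n ⟩
  j                           ∎
  where open ≡-Reasoning
... | no  n≮j = begin
  ∣ does (n <? j) ∷ top n j ∣ ≡⟨ cong (λ b → ∣ b ∷ top n j ∣) (dec-false (n <? j) n≮j) ⟩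
  ∣ top n j ∣                 ≡⟨ ∣top∣ n (≮⇒≥ n≮j) ⟩
  j                           ∎
  where open ≡-Reasoning

top-tabulate : ∀ n j → top n j ≡ tabulate (λ i → does (n ∸ val i <? j))
top-tabulate zero    j = refl
top-tabulate (suc n) j = cong (does (n <? j) ∷_) (top-tabulate n j)

∸≤⇔≤+ : ∀ m n o → m ∸ n ≤ o ⇔ m ≤ n + o
∸≤⇔≤+ m n o = mk⇔ (λ le → ≤-trans (m≤n+m∸n m n) (+-monoʳ-≤ n le)) (m≤n+o⇒m∸n≤o m n)

tailSet≡top : ∀ n j → tailSet n j ≡ top n j
tailSet≡top n j = trans (tabulate-cong inTail) (sym (top-tabulate n j))
  where
  -- With val i = suc t, both membership tests say n ≤ j + t.
  lower⇔ : ∀ t → n ∸ j + 1 ≤ suc t ⇔ n ≤ j + t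
  lower⇔ t = mk⇔
    (λ le → Equivalence.to (∸≤⇔≤+ n j t) (s≤s⁻¹ (subst (_≤ suc t) (+-comm (n ∸ j) 1) le)))
    (λ le → subst (_≤ suc t) (+-comm 1 (n ∸ j)) (s≤s (Equivalence.from (∸≤⇔≤+ n j t) le)))
  upper⇔ : ∀ t → suc t ≤ n → n ∸ suc t < j ⇔ n ≤ j + t
  upper⇔ t t<n = mk⇔
    (λ lt → subst (n ≤_) (+-comm t j) (Equivalence.to (∸≤⇔≤+ n t j) (subst (_≤ j) gap lt)))
    (λ le → subst (_≤ j) (sym gap) (Equivalence.from (∸≤⇔≤+ n t j) (subst (n ≤_) (+-comm j t) le)))
    where
    gap : suc (n ∸ suc t) ≡ n ∸ t
    gap = sym (+-∸-assoc 1 t<n)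
  inTail : ∀ (i : Fin n) → (does (n ∸ j + 1 ≤? val i) ∧ does (val i ≤? n)) ≡ does (n ∸ val i <? j)
  inTail i rewrite dec-true (val i ≤? n) (toℕ<n i) | ∧-identityʳ (does (n ∸ j + 1 ≤? val i)) =
    trans (does-⇔ (lower⇔ (toℕ i)) (n ∸ j + 1 ≤? val i) (n ≤? j + toℕ i))
          (sym (does-⇔ (upper⇔ (toℕ i) (toℕ<n i)) (n ∸ val i <? j) (n ≤? j + toℕ i)))

interval≡top : ∀ n {k h} → h ≤ k → k ≤ n → interval n (n ∸ k + h + 1) n ≡ top n (k ∸ h)
interval≡top n {k} {h} h≤k k≤n =
  trans (cong (λ z → interval n (z + 1) n) lower) (tailSet≡top n (k ∸ h))
  where
  open ≡-Reasoning
  lower : n ∸ k + h ≡ n ∸ (k ∸ h)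
  lower = begin
    n ∸ k + h               ≡⟨ +-∸-comm h k≤n ⟨
    n + h ∸ k               ≡⟨ cong (n + h ∸_) (m∸n+n≡m h≤k) ⟨
    n + h ∸ (k ∸ h + h)     ≡⟨ ∸-+-assoc (n + h) (k ∸ h) h ⟨
    n + h ∸ (k ∸ h) ∸ h     ≡⟨ cong (_∸ h) (+-∸-comm h (≤-trans (m∸n≤m k h) k≤n)) ⟩
    n ∸ (k ∸ h) + h ∸ h     ≡⟨ m+n∸n≡m _ h ⟩
    n ∸ (k ∸ h)             ∎

data Lex : ∀ {n} → Subset n → Subset n → Set where
  []      : Lex [] []
  _∷_     : ∀ {n} x {A B : Subset n} → Lex A B → Lex (x ∷ A) (x ∷ B)
  diverge : ∀ {n} {A B : Subset n} → Lex (true ∷ A) (false ∷ B)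

Lex-refl : ∀ {n} (A : Subset n) → Lex A A
Lex-refl []      = []
Lex-refl (x ∷ A) = x ∷ Lex-refl A

Lex-antisym : ∀ {n} {A B : Subset n} → Lex A B → Lex B A → A ≡ B
Lex-antisym []      []      = refl
Lex-antisym (x ∷ l) (_ ∷ m) = cong (x ∷_) (Lex-antisym l m)

Lex-tail : ∀ {n x} {A B : Subset n} → Lex (x ∷ A) (x ∷ B) → Lex A B
Lex-tail (_ ∷ l) = l

IsMin-there : ∀ {n} {S : Subset n} {i} → IsMin S i → IsMin (false ∷ S) (suc i)
IsMin-there (i∈S , i≤) = there i∈S , λ { {suc j} (there j∈S) → s≤s (i≤ j∈S) }

IsMin-untail : ∀ {n} {S : Subset n} {i} → IsMin (false ∷ S) i → ∃ λ i′ → i ≡ suc i′ × IsMin S i′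
IsMin-untail {i = suc i} (there i∈S , i≤) = i , refl , i∈S , λ j∈S → s≤s⁻¹ (i≤ (there j∈S))

IsMin-zero : ∀ {n} {S : Subset n} → IsMin (true ∷ S) zero
IsMin-zero = here , λ _ → s≤s z≤n

empty-or-min : ∀ {n} (S : Subset n) → (∀ i → i ∉ S) ⊎ ∃ (IsMin S)
empty-or-min []          = inj₁ λ ()
empty-or-min (true ∷ S)  = inj₂ (zero , IsMin-zero)
empty-or-min (false ∷ S) with empty-or-min S
... | inj₁ empty    = inj₁ λ { (suc i) (there i∈S) → empty i i∈S }
... | inj₂ (i , m) = inj₂ (suc i , IsMin-there m)

≺-∷ : ∀ {n} x {A B : Subset n} → A ≺ B → (x ∷ A) ≺ (x ∷ B)
≺-∷ x (inj₁ B⊆A) = inj₁ λ { here → here ; (there p) → there (B⊆A p) }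
≺-∷ true  (inj₂ (i , j , mi , mj , i<j)) = inj₂ (suc i , suc j , IsMin-there mi , IsMin-there mj , s≤s i<j)
≺-∷ false (inj₂ (i , j , mi , mj , i<j)) = inj₂ (suc i , suc j , IsMin-there mi , IsMin-there mj , s≤s i<j)

≺-tail : ∀ {n} x {A B : Subset n} → (x ∷ A) ≺ (x ∷ B) → A ≺ B
≺-tail x (inj₁ sub) = inj₁ (drop-∷-⊆ sub)
≺-tail true  (inj₂ (_ , _ , mi , mj , i<j)) with IsMin-untail mi | IsMin-untail mj
... | i , refl , mi′ | j , refl , mj′ = inj₂ (i , j , mi′ , mj′ , s<s⁻¹ i<j)
≺-tail false (inj₂ (_ , _ , mi , mj , i<j)) with IsMin-untail mi | IsMin-untail mj
... | i , refl , mi′ | j , refl , mj′ = inj₂ (i , j , mi′ , mj′ , s<s⁻¹ i<j)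

Lex⇒≺ : ∀ {n} {A B : Subset n} → Lex A B → A ≺ B
Lex⇒≺ []      = inj₁ λ ()
Lex⇒≺ (x ∷ l) = ≺-∷ x (Lex⇒≺ l)
Lex⇒≺ (diverge {A = A} {B}) with empty-or-min (B ─ A)
... | inj₂ (j , m) = inj₂ (zero , suc j , IsMin-zero , IsMin-there m , s≤s (s≤s z≤n))
... | inj₁ empty   = inj₁ B⊆A
  where
  B⊆A : (false ∷ B) ⊆ (true ∷ A)
  B⊆A {suc j} (there j∈B) with j ∈? A
  ... | yes j∈A = there j∈A
  ... | no  j∉A = ⊥-elim (empty j (x∈p∧x∉q⇒x∈p─q j∈B j∉A))

≺⇒Lex : ∀ {n} (A B : Subset n) → A ≺ B → Lex A B
≺⇒Lex []         []          _ = []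
≺⇒Lex (true ∷ A)  (false ∷ B) _ = diverge
≺⇒Lex (true ∷ A)  (true ∷ B)  p = true ∷ ≺⇒Lex A B (≺-tail true p)
≺⇒Lex (false ∷ A) (false ∷ B) p = false ∷ ≺⇒Lex A B (≺-tail false p)
≺⇒Lex (false ∷ A) (true ∷ B)  (inj₁ B⊆A) with B⊆A here
... | ()
≺⇒Lex (false ∷ A) (true ∷ B)  (inj₂ (i , j , mi , (_ , j≤) , i<j)) =
  ⊥-elim (<⇒≱ i<j (≤-trans (j≤ {zero} here) (s≤s z≤n)))

data Partners : ∀ {n} → Subset n → Subset n → Set where
  meet : ∀ {n} → Partners {suc n} (true ∷ ⊥) (true ∷ ⊥)
  inC  : ∀ {n} {C H : Subset n} → Partners C H → Partners (true ∷ C) (false ∷ H)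
  inH  : ∀ {n} {C H : Subset n} → Partners C H → Partners (false ∷ C) (true ∷ H)

tabulate-false : ∀ n → tabulate {n = n} (λ _ → false) ≡ ⊥
tabulate-false zero    = refl
tabulate-false (suc n) = cong (false ∷_) (tabulate-false n)

∪≡⊥ : ∀ {n} (C H : Subset n) → C ∪ H ≡ ⊥ → C ≡ ⊥ × H ≡ ⊥
∪≡⊥ []          []          _  = refl , refl
∪≡⊥ (false ∷ C) (false ∷ H) eq with ∪≡⊥ C H (∷-injectiveʳ eq)
... | refl , refl = refl , refl

IsPartner⇒Partners : ∀ {n} (C H : Subset n) → IsPartner C H → Partners C H
IsPartner⇒Partners {suc n} (true ∷ C) (true ∷ H) (zero , ∩≡ , ∪≡)
  with ∪≡⊥ C H (∷-injectiveʳ (trans ∪≡ (cong (true ∷_) (tabulate-false n))))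
... | refl , refl = meet
IsPartner⇒Partners (true ∷ C) (false ∷ H) (suc q , ∩≡ , ∪≡) =
  inC (IsPartner⇒Partners C H (q , ∷-injectiveʳ ∩≡ , ∷-injectiveʳ ∪≡))
IsPartner⇒Partners (false ∷ C) (true ∷ H) (suc q , ∩≡ , ∪≡) =
  inH (IsPartner⇒Partners C H (q , ∷-injectiveʳ ∩≡ , ∷-injectiveʳ ∪≡))
IsPartner⇒Partners (true ∷ C) (false ∷ H) (zero , () , _)
IsPartner⇒Partners (false ∷ C) (true ∷ H) (zero , () , _)
IsPartner⇒Partners (false ∷ C) (false ∷ H) (zero , () , _)
IsPartner⇒Partners (false ∷ C) (false ∷ H) (suc q , _ , ())
IsPartner⇒Partners (true ∷ C) (true ∷ H) (suc q , () , _)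

Partners-⊥ : ∀ {n} {H : Subset n} → ¬ Partners ⊥ H
Partners-⊥ (inH p) = Partners-⊥ p

Partners-unique : ∀ {n} {C H₁ H₂ : Subset n} → Partners C H₁ → Partners C H₂ → H₁ ≡ H₂
Partners-unique meet    meet    = refl
Partners-unique meet    (inC q) = ⊥-elim (Partners-⊥ q)
Partners-unique (inC p) meet    = ⊥-elim (Partners-⊥ p)
Partners-unique (inC p) (inC q) = cong (false ∷_) (Partners-unique p q)
Partners-unique (inH p) (inH q) = cong (true ∷_) (Partners-unique p q)

-- TopRun j V: V is u ∪ [n - j + 1, n] with n - j ∉ V, so ℓ(V) = j.
data TopRun : ∀ {n} → ℕ → Subset n → Set where
  gap  : ∀ {j} → TopRun j (false ∷ ⊤ {j})
  skip : ∀ {n j x} {V : Subset n} → TopRun j V → TopRun j (x ∷ V)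

TopRun-< : ∀ {n j} {V : Subset n} → TopRun j V → j < n
TopRun-< gap      = ≤-refl
TopRun-< (skip r) = m≤n⇒m≤1+n (TopRun-< r)

top-gap : ∀ j → top (suc j) j ≡ false ∷ ⊤
top-gap j = trans (top-outside j ≤-refl) (cong (false ∷_) (top-full j ≤-refl))

TopRun-top : ∀ m {j} → j < m → TopRun j (top m j)
TopRun-top (suc m) {j} (s≤s j≤m) with m ≟ j
... | yes refl = subst (TopRun j) (sym (top-gap j)) gap
... | no  m≢j  = subst (TopRun j) (sym (top-outside m j≤m))
                   (skip (TopRun-top m (≤∧≢⇒< j≤m (m≢j ∘ sym))))

TopRun-top⊆ : ∀ {n j} {V : Subset n} → TopRun j V → top n j ⊆ V
TopRun-top⊆ {j = j} gap rewrite top-gap j = λ p → p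
TopRun-top⊆ {suc n} {j} (skip r) rewrite top-outside n (<⇒≤ (TopRun-< r)) =
  λ { (there p) → there (TopRun-top⊆ r p) }

TopRun-maximal : ∀ {n j} {V : Subset n} → TopRun j V → ∀ y → top n y ⊆ V → y ≤ j
TopRun-maximal {j = j} gap y top⊆ with j <? y
... | no  j≮y = ≮⇒≥ j≮y
... | yes j<y with top⊆ (subst (zero ∈_) (cong (_∷ top j y) (sym (dec-true (j <? y) j<y))) here)
...   | ()
TopRun-maximal (skip r) y top⊆ = TopRun-maximal r y (drop-∷-⊆ top⊆)

TopRun-TopIn : ∀ {n j} {V : Subset n} → TopRun (suc j) V → TopIn V
TopRun-TopIn {j = j} gap = suc (fromℕ j) , there ∈⊤ , cong (λ k → suc (suc k)) (toℕ-fromℕ j)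
TopRun-TopIn (skip r) with TopRun-TopIn r
... | i , i∈V , val≡ = suc i , there i∈V , cong suc val≡

TopRun-¬TopIn : ∀ {n j} {V : Subset n} → TopRun j V → ¬ TopIn V → j ≡ 0
TopRun-¬TopIn {j = zero}  _ _    = refl
TopRun-¬TopIn {j = suc j} r ¬top = ⊥-elim (¬top (TopRun-TopIn r))

TopRun⇒IsEll : ∀ {n j} {V : Subset n} → TopRun j V → IsEll n V j
TopRun⇒IsEll {n} {j} {V} r = (λ _ → <⇒≤ (TopRun-< r) , tail⊆ , maximal) , TopRun-¬TopIn r
  where
  tail⊆ : tailSet n j ⊆ V
  tail⊆ = subst (_⊆ V) (sym (tailSet≡top n j)) (TopRun-top⊆ r)
  maximal : ∀ y → y ≤ n → tailSet n y ⊆ V → y ≤ j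
  maximal y _ sub = TopRun-maximal r y (subst (_⊆ V) (tailSet≡top n y) sub)

p─p≡⊥ : ∀ {n} (p : Subset n) → p ─ p ≡ ⊥
p─p≡⊥ []          = refl
p─p≡⊥ (true ∷ p)  = cong (false ∷_) (p─p≡⊥ p)
p─p≡⊥ (false ∷ p) = cong (false ∷_) (p─p≡⊥ p)

-- Room j C H: above the meet point q = ∣ H ∣ + ∣ C ∣ - 1 there is a gap
-- and then j more elements of [n].
record Room {n} (j : ℕ) (C H : Subset n) : Set where
  constructor room
  field bound : j + ∣ H ∣ + ∣ C ∣ ≤ n

room-meet : ∀ {j m} → Room j (true ∷ ⊥ {m}) (true ∷ ⊥) → j < m
room-meet {j} {m} (room le) rewrite ∣⊥∣≡0 m =
  s≤s⁻¹ (subst (_≤ suc m) (trans (+-assoc j 1 1) (+-comm j 2)) le)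

room-inC : ∀ {n j} {C H : Subset n} → Room j (true ∷ C) (false ∷ H) → Room j C H
room-inC {n} {j} {C} {H} (room le) = room (s≤s⁻¹ (subst (_≤ suc n) (+-suc (j + ∣ H ∣) ∣ C ∣) le))

room-inH : ∀ {n j} {C H : Subset n} → Room j (false ∷ C) (true ∷ H) → Room j C H
room-inH {n} {j} {C} {H} (room le) = room (s≤s⁻¹ (subst (λ z → z + ∣ C ∣ ≤ suc n) (+-suc j ∣ H ∣) le))

room⇒≤ : ∀ {n j} {C H : Subset n} → Room j C H → j ≤ n
room⇒≤ {j = j} {H = H} (room le) = m+n≤o⇒m≤o j (m+n≤o⇒m≤o (j + ∣ H ∣) le)

module _ {j : ℕ} where

  padded-TopRun : ∀ {n} {C H : Subset n} → Partners C H → Room j C H →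
                  TopRun j (H ∪ top n j)
  padded-TopRun {suc m} meet r =
    skip (subst (TopRun j) (sym (∪-identityˡ (top m j))) (TopRun-top m (room-meet r)))
  padded-TopRun (inC p) r = skip (padded-TopRun p (room-inC r))
  padded-TopRun (inH p) r = skip (padded-TopRun p (room-inH r))

  padded-─-top : ∀ {n} {C H : Subset n} → Partners C H → Room j C H →
                 (H ∪ top n j) ─ top n j ≡ H
  padded-─-top {suc m} meet r = begin
    ((true ∷ ⊥) ∪ top (suc m) j) ─ top (suc m) j
      ≡⟨ cong (λ V → ((true ∷ ⊥) ∪ V) ─ V) (top-outside m (<⇒≤ (room-meet r))) ⟩
    true ∷ ((⊥ ∪ top m j) ─ top m j)  ≡⟨ cong (λ V → true ∷ (V ─ top m j)) (∪-identityˡ (top m j)) ⟩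
    true ∷ (top m j ─ top m j)        ≡⟨ cong (true ∷_) (p─p≡⊥ (top m j)) ⟩
    true ∷ ⊥                          ∎
    where open ≡-Reasoning
  padded-─-top {suc n} {H = false ∷ H} (inC p) r =
    trans (cong (λ V → ((false ∷ H) ∪ V) ─ V) (top-outside n (room⇒≤ (room-inC r))))
          (cong (false ∷_) (padded-─-top p (room-inC r)))
  padded-─-top {suc n} {H = true ∷ H} (inH p) r =
    trans (cong (λ V → ((true ∷ H) ∪ V) ─ V) (top-outside n (room⇒≤ (room-inH r))))
          (cong (true ∷_) (padded-─-top p (room-inH r)))

  Lex-padded : ∀ {n} {C H B : Subset n} → Partners C H → Room j C H →
               Lex B H → ∣ B ∣ < ∣ H ∣ → Lex B (H ∪ top n j)
  Lex-padded {suc m} {B = _ ∷ B} meet _ (_ ∷ _) B<H =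
    ⊥-elim (n≮0 (subst (∣ B ∣ <_) (∣⊥∣≡0 m) (s<s⁻¹ B<H)))
  Lex-padded {suc n} {H = false ∷ H} {B} (inC p) r l B<H =
    subst (λ V → Lex B ((false ∷ H) ∪ V)) (sym (top-outside n (room⇒≤ (room-inC r)))) (step l)
    where
    step : Lex B (false ∷ H) → Lex B (false ∷ (H ∪ top n j))
    step (_ ∷ l′) = false ∷ Lex-padded p (room-inC r) l′ B<H
    step diverge  = diverge
  Lex-padded (inH p) r (_ ∷ l) B<H = true ∷ Lex-padded p (room-inH r) l (s<s⁻¹ B<H)

LexLastBelow : ∀ {n} → Subset n → Subset n → Set
LexLastBelow {n} H K = Lex K H × (∀ (K′ : Subset n) → ∣ K′ ∣ ≡ ∣ K ∣ → Lex K′ H → Lex K′ K)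

LexLastBelow-tail : ∀ {n x} {H K : Subset n} → LexLastBelow (x ∷ H) (x ∷ K) → LexLastBelow H K
LexLastBelow-tail {x = true} (_ ∷ K≼H , last) =
  K≼H , λ K′ ∣K′∣≡ K′≼H → Lex-tail (last (true ∷ K′) (cong suc ∣K′∣≡) (true ∷ K′≼H))
LexLastBelow-tail {x = false} (_ ∷ K≼H , last) =
  K≼H , λ K′ ∣K′∣≡ K′≼H → Lex-tail (last (false ∷ K′) ∣K′∣≡ (false ∷ K′≼H))

Lex-top : ∀ m (K : Subset m) → Lex K (top m ∣ K ∣)
Lex-top zero    []      = []
Lex-top (suc m) K with m <? ∣ K ∣
... | yes m<K = subst₂ Lex (sym K≡⊤) (sym (top-full (suc m) m<K)) (Lex-refl ⊤)
  where
  K≡⊤ : K ≡ ⊤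
  K≡⊤ = ∣p∣≡n⇒p≡⊤ (≤-antisym (∣p∣≤n K) m<K)
... | no  m≮K = subst (Lex K) (sym (top-outside m (≮⇒≥ m≮K))) (below K)
  where
  below : ∀ (K : Subset (suc m)) → Lex K (false ∷ top m ∣ K ∣)
  below (true ∷ K)  = diverge
  below (false ∷ K) = false ∷ Lex-top m K

Lex-resize : ∀ {n} {C W V : Subset n} → Partners C W → Lex V W → ∣ V ∣ < ∣ W ∣ →
             ∀ t → ∣ V ∣ ≤ t → t + ∣ C ∣ ≤ suc n → ∃ λ K → ∣ K ∣ ≡ t × Lex K W
Lex-resize {suc n} {V = _ ∷ V} meet (_ ∷ _) V<W _ _ _ =
  ⊥-elim (n≮0 (subst (∣ V ∣ <_) (∣⊥∣≡0 n) (s<s⁻¹ V<W)))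
Lex-resize (inH p) (_ ∷ l) V<W (suc t) V≤t t+C≤
  with Lex-resize p l (s<s⁻¹ V<W) t (s≤s⁻¹ V≤t) (s≤s⁻¹ t+C≤)
... | K , ∣K∣≡t , K≼W = true ∷ K , cong suc ∣K∣≡t , true ∷ K≼W
Lex-resize {suc n} {true ∷ C} (inC p) (_ ∷ l) V<W t V≤t t+C≤
  with Lex-resize p l V<W t V≤t (s≤s⁻¹ (subst (_≤ suc (suc n)) (+-suc t ∣ C ∣) t+C≤))
... | K , ∣K∣≡t , K≼W = false ∷ K , ∣K∣≡t , false ∷ K≼W
Lex-resize {suc n} {true ∷ C} (inC p) diverge V<W (suc t) V≤t t+C≤ =
  true ∷ top n t , cong suc (∣top∣ n t≤n) , diverge
  where
  t≤n : t ≤ n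
  t≤n = m+n≤o⇒m≤o t (s≤s⁻¹ (subst (_≤ suc n) (+-suc t ∣ C ∣) (s≤s⁻¹ t+C≤)))

Parity : ∀ {n} → ℕ → ℕ → Subset n → Subset n → Set
Parity {n} b a B A = ∃₂ λ x₁ x₂ → TopRun x₁ B × TopRun x₂ A ×
  (B ─ top n x₁ ≡ A ─ top n x₂) × (x₂ + b ≡ x₁ + a)

Parity⇒IsParity : ∀ {n b a} {B A : Subset n} → Parity b a B A → IsParity n b a B A
Parity⇒IsParity {n} {B = B} {A} (x₁ , x₂ , r₁ , r₂ , same , size) =
  x₁ , x₂ , TopRun⇒IsEll r₁ , TopRun⇒IsEll r₂ ,
  trans (cong (B ─_) (tailSet≡top n x₁)) (trans same (cong (A ─_) (sym (tailSet≡top n x₂)))) , size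

∷-─-top : ∀ {n} x (B : Subset n) {r} → r ≤ n → (x ∷ B) ─ top (suc n) r ≡ x ∷ (B ─ top n r)
∷-─-top true  B r≤n = cong ((true ∷ B) ─_) (top-outside _ r≤n)
∷-─-top false B r≤n = cong ((false ∷ B) ─_) (top-outside _ r≤n)

Parity-∷ : ∀ {n} x {B A : Subset n} → Parity ∣ B ∣ ∣ A ∣ B A → Parity ∣ x ∷ B ∣ ∣ x ∷ A ∣ (x ∷ B) (x ∷ A)
Parity-∷ x {B} {A} (x₁ , x₂ , r₁ , r₂ , same , size) =
  x₁ , x₂ , skip r₁ , skip r₂ ,
  trans (∷-─-top x B (<⇒≤ (TopRun-< r₁)))
        (trans (cong (x ∷_) same) (sym (∷-─-top x A (<⇒≤ (TopRun-< r₂))))) ,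
  size′ x
  where
  size′ : ∀ x → x₂ + ∣ x ∷ B ∣ ≡ x₁ + ∣ x ∷ A ∣
  size′ true  = trans (+-suc x₂ ∣ B ∣) (trans (cong suc size) (sym (+-suc x₁ ∣ A ∣)))
  size′ false = size

LexLastBelow-diverge : ∀ {n} {H A : Subset n} → LexLastBelow (false ∷ H) (true ∷ A) → A ≡ top n ∣ A ∣
LexLastBelow-diverge {n} {A = A} (_ , last) =
  Lex-antisym (Lex-top n A) (Lex-tail (last (true ∷ top n ∣ A ∣) (cong suc (∣top∣ n (∣p∣≤n A))) diverge))

top-Parity : ∀ {n r s} → r < n → s < n →
             Parity (suc r) (suc s) (true ∷ top n r) (true ∷ top n s)
top-Parity {n} {r} {s} r<n s<n =
  r , s , skip (TopRun-top n r<n) , skip (TopRun-top n s<n) ,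
  trans (only-bottom r<n) (sym (only-bottom s<n)) ,
  trans (+-suc s r) (trans (cong suc (+-comm s r)) (sym (+-suc r s)))
  where
  only-bottom : ∀ {t} → t < n → (true ∷ top n t) ─ top (suc n) t ≡ true ∷ ⊥
  only-bottom {t} t<n = trans (∷-─-top true (top n t) (<⇒≤ t<n)) (cong (true ∷_) (p─p≡⊥ (top n t)))

LexLastBelow-lex-or-parity :
  ∀ {n} {C H A B : Subset n} → Partners C H → LexLastBelow H A → LexLastBelow H B →
  ∣ B ∣ ≤ ∣ A ∣ → ∣ A ∣ < ∣ H ∣ → ∣ A ∣ + ∣ C ∣ ≤ n → Lex B A ⊎ Parity ∣ B ∣ ∣ A ∣ B A
LexLastBelow-lex-or-parity {suc n} {A = _ ∷ A} meet (_ ∷ _ , _) _ _ A<H _ =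
  ⊥-elim (n≮0 (subst (∣ A ∣ <_) (∣⊥∣≡0 n) (s<s⁻¹ A<H)))
LexLastBelow-lex-or-parity (inH p) lastA@(_ ∷ _ , _) lastB@(_ ∷ _ , _) B≤A A<H A+C≤ =
  Sum.map (true ∷_) (Parity-∷ true)
    (LexLastBelow-lex-or-parity p (LexLastBelow-tail lastA) (LexLastBelow-tail lastB)
      (s≤s⁻¹ B≤A) (s<s⁻¹ A<H) (s≤s⁻¹ A+C≤))
LexLastBelow-lex-or-parity {suc n} {true ∷ C} {A = _ ∷ A}
                           (inC p) lastA@(_ ∷ _ , _) lastB@(_ ∷ _ , _) B≤A A<H A+C≤ =
  Sum.map (false ∷_) (Parity-∷ false)
    (LexLastBelow-lex-or-parity p (LexLastBelow-tail lastA) (LexLastBelow-tail lastB)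
      B≤A A<H (s≤s⁻¹ (subst (_≤ suc n) (+-suc ∣ A ∣ ∣ C ∣) A+C≤)))
LexLastBelow-lex-or-parity (inC p) (_ ∷ _ , _) (diverge , _) _ _ _ = inj₁ diverge
LexLastBelow-lex-or-parity {suc n} {true ∷ C} {A = true ∷ A} (inC p) (diverge , last) (_ ∷ B≼H , _)
                           B≤A A<H A+C≤
  -- B shows that an a-set following H here still precedes H; it would come after A.
  with Lex-resize p B≼H (≤-<-trans B≤A A<H) (suc ∣ A ∣) B≤A
         (≤-trans (+-monoʳ-≤ (suc ∣ A ∣) (n≤1+n ∣ C ∣)) A+C≤)
... | K , ∣K∣≡ , K≼H with last (false ∷ K) ∣K∣≡ (false ∷ K≼H)
...   | ()
LexLastBelow-lex-or-parity {suc n} {true ∷ C} {A = true ∷ A} {true ∷ B}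
                           (inC p) lastA@(diverge , _) lastB@(diverge , _) B≤A _ A+C≤ =
  inj₂ (subst₂ (λ X Y → Parity (suc ∣ B ∣) (suc ∣ A ∣) (true ∷ X) (true ∷ Y))
          (sym (LexLastBelow-diverge lastB)) (sym (LexLastBelow-diverge lastA))
          (top-Parity (≤-<-trans (s≤s⁻¹ B≤A) A<n) A<n))
  where
  A<n : ∣ A ∣ < n
  A<n = m+n≤o⇒m≤o (suc ∣ A ∣) (s≤s⁻¹ (subst (_≤ suc n) (+-suc (suc ∣ A ∣) ∣ C ∣) A+C≤))

KPartnerView : ∀ {n} → Subset n → ℕ → Subset n → Set
KPartnerView {n} H k K =
  (∣ H ∣ ≤ k × K ≡ H ∪ top n (k ∸ ∣ H ∣)) ⊎ (k < ∣ H ∣ × ∣ K ∣ ≡ k × LexLastBelow H K)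

IsKPartner⇒view : ∀ {n k} {C K : Subset n} → k ≤ n → IsKPartner n k C K →
                  ∃ λ H → Partners C H × KPartnerView H k K
IsKPartner⇒view {n} {k} {C} {K} k≤n (H , partner , kind) =
  H , IsPartner⇒Partners C H partner , view kind
  where
  view : (k ≡ ∣ H ∣ × K ≡ H) ⊎ (∣ H ∣ < k × K ≡ H ∪ interval n (n ∸ k + ∣ H ∣ + 1) n)
           ⊎ (k < ∣ H ∣ × IsLexLast k H K) →
         KPartnerView H k K
  view (inj₁ (refl , refl)) = inj₁ (≤-refl , sym (begin
    H ∪ top n (∣ H ∣ ∸ ∣ H ∣)  ≡⟨ cong (λ j → H ∪ top n j) (n∸n≡0 ∣ H ∣) ⟩
    H ∪ top n 0                ≡⟨ cong (H ∪_) (top-zero n) ⟩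
    H ∪ ⊥                      ≡⟨ ∪-identityʳ H ⟩
    H                          ∎))
    where open ≡-Reasoning
  view (inj₂ (inj₁ (H<k , K≡))) =
    inj₁ (<⇒≤ H<k , trans K≡ (cong (H ∪_) (interval≡top n (<⇒≤ H<k) k≤n)))
  view (inj₂ (inj₂ (k<H , ∣K∣≡k , K≺H , last))) =
    inj₂ (k<H , ∣K∣≡k , ≺⇒Lex K H K≺H ,
          λ K′ ∣K′∣≡ K′≼H → ≺⇒Lex K′ K (last K′ (trans ∣K′∣≡ ∣K∣≡k) (Lex⇒≺ K′≼H)))

room-padding : ∀ {n k} {C H : Subset n} → ∣ H ∣ ≤ k → k + ∣ C ∣ ≤ n → Room (k ∸ ∣ H ∣) C H
room-padding {C = C} H≤k k+C≤n = room (subst (λ z → z + ∣ C ∣ ≤ _) (sym (m∸n+n≡m H≤k)) k+C≤n)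

padded-Parity : ∀ {n a b} {C H : Subset n} → Partners C H → ∣ H ∣ ≤ b → b ≤ a → a + ∣ C ∣ ≤ n →
                Parity b a (H ∪ top n (b ∸ ∣ H ∣)) (H ∪ top n (a ∸ ∣ H ∣))
padded-Parity {n} {a} {b} {C} {H} p H≤b b≤a a+C≤n =
  b ∸ ∣ H ∣ , a ∸ ∣ H ∣ , padded-TopRun p roomB , padded-TopRun p roomA ,
  trans (padded-─-top p roomB) (sym (padded-─-top p roomA)) , size
  where
  open ≡-Reasoning
  H≤a : ∣ H ∣ ≤ a
  H≤a = ≤-trans H≤b b≤a
  roomA : Room (a ∸ ∣ H ∣) C H
  roomA = room-padding H≤a a+C≤n
  roomB : Room (b ∸ ∣ H ∣) C H
  roomB = room-padding H≤b (≤-trans (+-monoˡ-≤ ∣ C ∣ b≤a) a+C≤n)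
  size : a ∸ ∣ H ∣ + b ≡ b ∸ ∣ H ∣ + a
  size = begin
    a ∸ ∣ H ∣ + b  ≡⟨ +-∸-comm b H≤a ⟨
    a + b ∸ ∣ H ∣  ≡⟨ cong (_∸ ∣ H ∣) (+-comm a b) ⟩
    b + a ∸ ∣ H ∣  ≡⟨ +-∸-comm a H≤b ⟩
    b ∸ ∣ H ∣ + a  ∎

KPartnerView-lex-or-parity : ∀ {n a b} {C H A B : Subset n} → Partners C H → b ≤ a → a + ∣ C ∣ ≤ n →
  KPartnerView H a A → KPartnerView H b B → Lex B A ⊎ Parity b a B A
KPartnerView-lex-or-parity p b≤a a+C≤n (inj₁ (_ , refl)) (inj₁ (H≤b , refl)) =
  inj₂ (padded-Parity p H≤b b≤a a+C≤n)
KPartnerView-lex-or-parity p b≤a _ (inj₂ (a<H , _)) (inj₁ (H≤b , _)) =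
  ⊥-elim (<⇒≱ a<H (≤-trans H≤b b≤a))
KPartnerView-lex-or-parity p _ a+C≤n (inj₁ (H≤a , refl)) (inj₂ (b<H , refl , B≼H , _)) =
  inj₁ (Lex-padded p (room-padding H≤a a+C≤n) B≼H b<H)
KPartnerView-lex-or-parity p b≤a a+C≤n (inj₂ (a<H , refl , lastA)) (inj₂ (_ , refl , lastB)) =
  LexLastBelow-lex-or-parity p lastA lastB b≤a a<H a+C≤n

fact2p17 : (a b c n : ℕ) → 1 ≤ a → 1 ≤ b → 1 ≤ c → b ≤ a → a + c ≤ n →
    (C : Subset n) → ∣ C ∣ ≡ c → (A B : Subset n) →
    IsKPartner n a C A → IsKPartner n b C B →
    B ≺ A ⊎ IsParity n b a B A
fact2p17 a b c n _ _ _ b≤a a+c≤n C refl A B kA kB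
  with IsKPartner⇒view (m+n≤o⇒m≤o a a+c≤n) kA | IsKPartner⇒view (≤-trans b≤a (m+n≤o⇒m≤o a a+c≤n)) kB
... | H , pA , viewA | _ , pB , viewB with Partners-unique pA pB
... | refl = Sum.map Lex⇒≺ Parity⇒IsParity (KPartnerView-lex-or-parity pA b≤a a+c≤n viewA viewB)
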